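{- Let $G$ be a cyclic group of order $p_1p_2$, where $p_1,p_2$ are distinct primes. Then $OD(G)$ is isomorphic to the sequential join $(G_1\diamond G_2\diamond G_3)\diamond K_1$, where $G_1\cong (p_1-1)K_1$, $G_2\cong (p_1-1)(p_2-1)K_1$ and $G_3\cong (p_2-1)K_1$.
   Context: For a finite group $G$, the order divisor graph $OD(G)$ is the simple undirected graph with vertex set $G$ in which two distinct vertices $a,b$ are adjacent if and only if $o(a)\neq o(b)$ and either $o(a)\mid o(b)$ or $o(b)\mid o(a)$. $mK_1$ denotes the edgeless graph on $m$ vertices. For graphs $H_1,\dots,H_k$ on disjoint vertex sets, the sequential join $H_1\diamond H_2\diamond\cdots\diamond H_k$ is the graph on the union of their vertex sets, containing all edges of each $H_i$, together with all edges joining each vertex of $H_i$ to each vertex of $H_{i+1}$ for $1\leq i\leq k-1$ (and no other edges). Thus $(G_1\diamond G_2\diamond G_3)\diamond K_1$ is obtained from $G_1\diamond G_2\diamond G_3$ by adding one new vertex adjacent to all of its vertices. -}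

module Defs where

open import Level using (Level; _⊔_; 0ℓ)
open import Algebra.Bundles using (Group)
open import Data.Nat using (ℕ; zero; suc; _*_; _∸_; _<_)
open import Data.Nat.Divisibility using (_∣_)
open import Data.Fin using (Fin)
open import Data.Unit using (⊤)
open import Data.Sum using (_⊎_; inj₁; inj₂)
open import Data.Product using (Σ; ∃; ∃-syntax; _×_; _,_)
open import Data.Empty using (⊥)
open import Relation.Nullary using (¬_)
open import Relation.Binary.PropositionalEquality using (_≡_)
open import Function.Bundles using (_⇔_)

module _ {c ℓ : Level} (G : Group c ℓ) where
  open Group G

  pow : Carrier → ℕ → Carrier
  pow g zero    = ε
  pow g (suc k) = g ∙ pow g k

  HasOrder : ℕ → Set (c ⊔ ℓ)
  HasOrder n = Σ (Fin n → Carrier) λ e →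
                 (∀ i j → e i ≈ e j → i ≡ j) × (∀ x → ∃[ i ] (e i ≈ x))

  IsCyclic : Set (c ⊔ ℓ)
  IsCyclic = ∃[ g ] (∀ x → ∃[ k ] (x ≈ pow g k))

  IsElemOrder : Carrier → ℕ → Set ℓ
  IsElemOrder g k = (0 < k) × (pow g k ≈ ε) ×
                    (∀ j → 0 < j → j < k → ¬ (pow g j ≈ ε))

  ODAdj : Carrier → Carrier → Set ℓ
  ODAdj a b = ¬ (a ≈ b) × ∃[ k ] ∃[ l ]
                (IsElemOrder a k × IsElemOrder b l × ¬ (k ≡ l) × (k ∣ l ⊎ l ∣ k))

record Graph : Set₁ where
  field
    V   : Set
    Adj : V → V → Set
open Graph public

emptyGraph : ℕ → Graph
emptyGraph m = record { V = Fin m ; Adj = λ _ _ → ⊥ }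

K₁ : Graph
K₁ = emptyGraph 1

_◇_ : Graph → Graph → Graph
H₁ ◇ H₂ = record { V = V H₁ ⊎ V H₂ ; Adj = adj }
  where
  adj : V H₁ ⊎ V H₂ → V H₁ ⊎ V H₂ → Set
  adj (inj₁ x) (inj₁ y) = Adj H₁ x y
  adj (inj₂ x) (inj₂ y) = Adj H₂ x y
  adj (inj₁ _) (inj₂ _) = ⊤
  adj (inj₂ _) (inj₁ _) = ⊤

seqJoin3 : Graph → Graph → Graph → Graph
seqJoin3 H₁ H₂ H₃ = record { V = V H₁ ⊎ V H₂ ⊎ V H₃ ; Adj = adj }
  where
  adj : V H₁ ⊎ V H₂ ⊎ V H₃ → V H₁ ⊎ V H₂ ⊎ V H₃ → Set
  adj (inj₁ x)        (inj₁ y)        = Adj H₁ x y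
  adj (inj₂ (inj₁ x)) (inj₂ (inj₁ y)) = Adj H₂ x y
  adj (inj₂ (inj₂ x)) (inj₂ (inj₂ y)) = Adj H₃ x y
  adj (inj₁ _)        (inj₂ (inj₁ _)) = ⊤
  adj (inj₂ (inj₁ _)) (inj₁ _)        = ⊤
  adj (inj₂ (inj₁ _)) (inj₂ (inj₂ _)) = ⊤
  adj (inj₂ (inj₂ _)) (inj₂ (inj₁ _)) = ⊤
  adj (inj₁ _)        (inj₂ (inj₂ _)) = ⊥
  adj (inj₂ (inj₂ _)) (inj₁ _)        = ⊥

module _ {c ℓ : Level} (G : Group c ℓ) where
  open Group G

  ODIso : Graph → Set (c ⊔ ℓ)
  ODIso H = Σ (Carrier → V H) λ f →
              (∀ a b → a ≈ b → f a ≡ f b) ×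
              (∀ a b → f a ≡ f b → a ≈ b) ×
              (∀ v → ∃[ a ] (f a ≡ v)) ×
              (∀ a b → ODAdj G a b ⇔ Adj H (f a) (f b))

module Submission where

-- Since |G| = pq, g has order pq, so every x is gʳ for a unique
-- r < pq, and o(gʳ) is the additive order of r modulo pq: 1 for r = 0, p for the p − 1
-- nonzero multiples of q, q for the q − 1 nonzero multiples of p, and pq for the
-- (p − 1)(q − 1) remaining residues. Among 1, p, q, pq any two distinct values are
-- comparable under divisibility except p and q, which is exactly the adjacency of the
-- sequential join; the resulting injection of G into its pq vertices is onto by counting.

open import Defs
open import Level using (Level)
open import Algebra.Bundles using (Group)
open import Data.Nat using (ℕ; _*_; _∸_)
open import Data.Nat.Primality using (Prime)
open import Relation.Nullary using (¬_)
open import Relation.Binary.PropositionalEquality using (_≡_)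

open import Data.Nat.Base
  using (zero; suc; _+_; _≤_; _<_; NonZero; >-nonZero; >-nonZero⁻¹; nonTrivial⇒n>1; nonTrivial⇒≢1;
         z<s; s<s; s<s⁻¹)
open import Data.Nat.Properties
  using (<-cmp; ≤-total; <⇒≤; <⇒≢; ≤-antisym; ≤-trans; ≤-<-trans; <⇒≱; m∸n≤m; m∸n≡0⇒m≤n; m<n⇒0<n∸m;
         m+[n∸m]≡n; n<1+n; m<m*n; m≤m*n; m*n≢0; *-comm; *-cancelʳ-<; [m+n]∸[m+o]≡n∸o; *-distribʳ-∸)
open import Data.Nat.Divisibility
  using (_∣_; _∤_; _∣?_; divides; _∣0; 1∣_; ∣-trans; m∣m*n; n∣m*n; *-monoˡ-∣; *-monoʳ-∣; >⇒∤;
         m%n≡0⇒n∣m; n∣m⇒m%n≡0)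
open import Data.Nat.DivMod using (_%_; _/_; m%n<n; m≡m%n+[m/n]*n)
open import Data.Nat.Primality using (euclidsLemma; prime⇒irreducible; prime⇒nonTrivial; prime⇒nonZero; ¬prime[0])
open import Data.Fin.Base using (Fin; toℕ; fromℕ<; combine; punchOut)
  renaming (zero to fzero)
open import Data.Fin.Properties
  using (toℕ<n; toℕ≤pred[n]; toℕ-injective; toℕ-fromℕ<; fromℕ<-injective; combine-injective;
         pigeonhole; injective⇒≤; punchOut-injective; any?; +↔⊎)
  renaming (_≟_ to _≟ᶠ_; <⇒≢ to <⇒≢ᶠ)
open import Data.Nat.Tactic.RingSolver using (solve-∀)
open import Data.Sum.Base using (_⊎_; inj₁; inj₂; swap)
open import Data.Sum.Function.Propositional using (_⊎-↔_)
open import Data.Sum.Properties using (inj₁-injective; inj₂-injective)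
open import Data.Product.Base using (Σ; ∃; ∃-syntax; _×_; _,_; proj₁; proj₂; uncurry)
open import Data.Unit.Base using (⊤; tt)
open import Data.Empty using (⊥; ⊥-elim)
open import Function.Base using (_∘_)
open import Function.Bundles using (_⇔_; mk⇔; Equivalence; _↔_; _↣_; Injection)
open import Function.Definitions using (Injective)
open import Function.Construct.Composition using (_⇔-∘_)
open import Function.Construct.Symmetry using (⇔-sym; ↔-sym)
open import Function.Properties.Inverse using (↔-refl; ↔-trans; ↔⇒↣)
open import Relation.Nullary using (yes; no; contradiction; contradiction-irr)
open import Relation.Binary.Definitions using (tri<; tri≈; tri>)
open import Relation.Binary.PropositionalEquality as ≡
  using (_≢_; refl; cong; cong₂; subst; subst₂; module ≡-Reasoning)

IsLeastPositive : ∀ {ℓ} → (ℕ → Set ℓ) → ℕ → Set ℓ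
IsLeastPositive P k = 0 < k × P k × (∀ j → 0 < j → j < k → ¬ P j)

IsLeastPositive-unique : ∀ {ℓ} (P : ℕ → Set ℓ) {k l} →
                         IsLeastPositive P k → IsLeastPositive P l → k ≡ l
IsLeastPositive-unique P {k} {l} (k>0 , Pk , k-least) (l>0 , Pl , l-least) with <-cmp k l
... | tri< k<l _ _ = contradiction Pk (l-least k k>0 k<l)
... | tri≈ _ k≡l _ = k≡l
... | tri> _ _ l<k = contradiction Pl (k-least l l>0 l<k)

IsLeastPositive-resp-⇔ : ∀ {ℓ ℓ′} {P : ℕ → Set ℓ} {Q : ℕ → Set ℓ′} {k} →
                         (∀ j → P j ⇔ Q j) → IsLeastPositive P k → IsLeastPositive Q k
IsLeastPositive-resp-⇔ P⇔Q (k>0 , Pk , k-least) =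
  k>0 , Equivalence.to (P⇔Q _) Pk ,
  λ j j>0 j<k Qj → k-least j j>0 j<k (Equivalence.from (P⇔Q j) Qj)

Fin-injective⇒surjective : ∀ {n} (h : Fin n → Fin n) → Injective _≡_ _≡_ h →
                           ∀ y → ∃ λ x → h x ≡ y
Fin-injective⇒surjective {suc n} h h-injective y with any? (λ x → h x ≟ᶠ y)
... | yes hit = hit
... | no miss
  -- a missed y makes h an injection of Fin (suc n) into the n values other than y
  with i , j , i<j , hᵢ≡hⱼ ← pigeonhole (n<1+n n) (λ x → punchOut λ y≡hx → miss (x , ≡.sym y≡hx))
  = contradiction (h-injective (punchOut-injective {i = y} _ _ hᵢ≡hⱼ)) (<⇒≢ᶠ i<j)

injective⇒surjective : ∀ {a} {A : Set a} {n} {f : Fin n → A} {g : A → Fin n} →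
                       Injective _≡_ _≡_ f → Injective _≡_ _≡_ g →
                       ∀ y → ∃ λ x → f x ≡ y
injective⇒surjective {f = f} {g} f-injective g-injective y
  with x , gfx≡gy ← Fin-injective⇒surjective (g ∘ f) (f-injective ∘ g-injective) (g y)
  = x , g-injective gfx≡gy

prime∤prime : ∀ {p q} → Prime p → Prime q → p ≢ q → p ∤ q
prime∤prime p-prime q-prime p≢q p∣q with prime⇒irreducible q-prime p∣q
... | inj₁ p≡1 = nonTrivial⇒≢1 {{prime⇒nonTrivial p-prime}} p≡1
... | inj₂ p≡q = p≢q p≡q

euclidsLemma-∤ʳ : ∀ {p} m n → Prime p → p ∤ n → p ∣ m * n → p ∣ m
euclidsLemma-∤ʳ m n p-prime p∤n p∣mn with euclidsLemma m n p-prime p∣mn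
... | inj₁ p∣m = p∣m
... | inj₂ p∣n = contradiction p∣n p∤n

prime∤* : ∀ {p m n} → Prime p → p ∤ m → p ∤ n → p ∤ m * n
prime∤* p-prime p∤m p∤n p∣mn with euclidsLemma _ _ p-prime p∣mn
... | inj₁ p∣m = p∤m p∣m
... | inj₂ p∣n = p∤n p∣n

distinct-primes-∣⇒*∣ : ∀ {p q m} → Prime p → Prime q → p ≢ q → p ∣ m → q ∣ m → p * q ∣ m
distinct-primes-∣⇒*∣ {p} {q} p-prime q-prime p≢q (divides k refl) q∣kp =
  subst (_∣ k * p) (*-comm q p)
        (*-monoˡ-∣ p (euclidsLemma-∤ʳ k p q-prime (prime∤prime q-prime p-prime (p≢q ∘ ≡.sym)) q∣kp))

∣∧<⇒≡0 : ∀ {d m} → d ∣ m → m < d → m ≡ 0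
∣∧<⇒≡0 {m = zero}  _   _   = refl
∣∧<⇒≡0 {m = suc _} d∣m m<d = contradiction d∣m (>⇒∤ m<d)

%-≡⇒∣∸ : ∀ {m n} d .{{_ : NonZero d}} → m ≤ n → m % d ≡ n % d → d ∣ n ∸ m
%-≡⇒∣∸ {m} {n} d m≤n m%d≡n%d = divides (n / d ∸ m / d) (begin
  n ∸ m                                   ≡⟨ cong₂ _∸_ (m≡m%n+[m/n]*n n d) (m≡m%n+[m/n]*n m d) ⟩
  (n % d + n / d * d) ∸ (m % d + m / d * d) ≡⟨ cong (λ r → (r + n / d * d) ∸ (m % d + m / d * d))
                                                    (≡.sym m%d≡n%d) ⟩
  (m % d + n / d * d) ∸ (m % d + m / d * d) ≡⟨ [m+n]∸[m+o]≡n∸o (m % d) _ _ ⟩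
  n / d * d ∸ m / d * d                   ≡⟨ *-distribʳ-∸ d (n / d) (m / d) ⟨
  (n / d ∸ m / d) * d                     ∎)
  where open ≡-Reasoning

%≡suc⇒∤ : ∀ {d r i} .{{_ : NonZero d}} → r % d ≡ suc i → d ∤ r
%≡suc⇒∤ {d} {r} r%d≡1+i d∣r with () ← ≡.trans (≡.sym (n∣m⇒m%n≡0 r d d∣r)) r%d≡1+i

nonzero-remainder : ∀ {k} r → suc k ∤ r → Σ (Fin k) λ i → r % suc k ≡ suc (toℕ i)
nonzero-remainder {k} r k+1∤r with r % suc k in r%k+1≡ | m%n<n r (suc k)
... | zero  | _     = contradiction (m%n≡0⇒n∣m r (suc k) r%k+1≡) k+1∤r
... | suc i | i<k+1 = fromℕ< (s<s⁻¹ i<k+1) , cong suc (≡.sym (toℕ-fromℕ< _))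

positive-quotient : ∀ {k d r} s → .(suc r < suc k * d) → suc r ≡ s * d →
                    Σ (Fin k) λ t → suc r ≡ d * suc (toℕ t)
positive-quotient {k} {d} (suc s) r<kd r≡sd =
  fromℕ< (s<s⁻¹ (*-cancelʳ-< d (suc s) (suc k) (subst (_< suc k * d) r≡sd r<kd))) ,
  ≡.trans r≡sd (≡.trans (*-comm (suc s) d) (cong (λ i → d * suc i) (≡.sym (toℕ-fromℕ< _))))

IsOrderMod : ℕ → ℕ → ℕ → Set
IsOrderMod d r = IsLeastPositive (λ m → d ∣ m * r)

IsOrderMod-zero : ∀ d → IsOrderMod d 0 1
IsOrderMod-zero d = z<s , d ∣0 , λ { j j>0 (s<s j≤0) _ → <⇒≱ j>0 j≤0 }

IsOrderMod-prime : ∀ {p d r} → Prime p → p ∤ r → p ∣ d → d ∣ p * r → IsOrderMod d r p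
IsOrderMod-prime {p} {r = r} p-prime p∤r p∣d d∣pr =
  >-nonZero⁻¹ p {{prime⇒nonZero p-prime}} , d∣pr ,
  λ j j>0 j<p d∣jr → >⇒∤ {{>-nonZero j>0}} j<p (euclidsLemma-∤ʳ j r p-prime p∤r (∣-trans p∣d d∣jr))

module _ {p q : ℕ} .{{_ : NonZero p}} .{{_ : NonZero q}}
         (p-prime : Prime p) (q-prime : Prime q) (p≢q : p ≢ q) where

  private
    ≡-mod-pq⇒≥ : ∀ {m n} → m ≤ n → n < p * q → m % p ≡ n % p → m % q ≡ n % q → n ≤ m
    ≡-mod-pq⇒≥ {m} {n} m≤n n<pq m≡n[p] m≡n[q] =
      m∸n≡0⇒m≤n (∣∧<⇒≡0 (distinct-primes-∣⇒*∣ p-prime q-prime p≢q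
                                                (%-≡⇒∣∸ p m≤n m≡n[p]) (%-≡⇒∣∸ q m≤n m≡n[q]))
                        (≤-<-trans (m∸n≤m n m) n<pq))

  chineseRemainder-unique : ∀ {m n} → m < p * q → n < p * q →
                            m % p ≡ n % p → m % q ≡ n % q → m ≡ n
  chineseRemainder-unique {m} {n} m<pq n<pq m≡n[p] m≡n[q] with ≤-total m n
  ... | inj₁ m≤n = ≤-antisym m≤n (≡-mod-pq⇒≥ m≤n n<pq m≡n[p] m≡n[q])
  ... | inj₂ n≤m = ≤-antisym (≡-mod-pq⇒≥ n≤m m<pq (≡.sym m≡n[p]) (≡.sym m≡n[q])) n≤m

  IsOrderMod-coprime : ∀ {r} → p ∤ r → q ∤ r → IsOrderMod (p * q) r (p * q)
  IsOrderMod-coprime {r} p∤r q∤r =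
    >-nonZero⁻¹ (p * q) {{m*n≢0 p q}} , m∣m*n r ,
    λ j j>0 j<pq pq∣jr → >⇒∤ {{>-nonZero j>0}} j<pq
      (distinct-primes-∣⇒*∣ p-prime q-prime p≢q
        (euclidsLemma-∤ʳ j r p-prime p∤r (∣-trans (m∣m*n q) pq∣jr))
        (euclidsLemma-∤ʳ j r q-prime q∤r (∣-trans (n∣m*n p) pq∣jr)))

OrderRelated : ℕ → ℕ → Set
OrderRelated k l = k ≢ l × (k ∣ l ⊎ l ∣ k)

OrderRelated-irrefl : ∀ {k} → ¬ OrderRelated k k
OrderRelated-irrefl (k≢k , _) = k≢k refl

OrderRelated-sym : ∀ {k l} → OrderRelated k l → OrderRelated l k
OrderRelated-sym (k≢l , k∣l⊎l∣k) = k≢l ∘ ≡.sym , swap k∣l⊎l∣k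

<∧∣⇒OrderRelated : ∀ {k l} → k < l → k ∣ l → OrderRelated k l
<∧∣⇒OrderRelated k<l k∣l = <⇒≢ k<l , inj₁ k∣l

distinct-primes-unrelated : ∀ {p q} → Prime p → Prime q → p ≢ q → ¬ OrderRelated p q
distinct-primes-unrelated p-prime q-prime p≢q (_ , inj₁ p∣q) = prime∤prime p-prime q-prime p≢q p∣q
distinct-primes-unrelated p-prime q-prime p≢q (_ , inj₂ q∣p) =
  prime∤prime q-prime p-prime (p≢q ∘ ≡.sym) q∣p

module _ {c ℓ : Level} (G : Group c ℓ) where
  open Group G renaming (refl to ≈-refl)
  open import Algebra.Properties.Monoid.Mult monoid using (×-congʳ; ×-homo-+; ×-assocˡ)
    renaming (_×_ to _·_)
  open import Algebra.Properties.Group G using (∙-cancelˡ)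
  open import Relation.Binary.Reasoning.Setoid setoid

  pow≡· : ∀ x k → pow G x k ≡ k · x
  pow≡· x zero    = refl
  pow≡· x (suc k) = cong (x ∙_) (pow≡· x k)

  pow-cong : ∀ k {x y} → x ≈ y → pow G x k ≈ pow G y k
  pow-cong k {x} {y} x≈y rewrite pow≡· x k | pow≡· y k = ×-congʳ k x≈y

  pow-+ : ∀ x i j → pow G x (i + j) ≈ pow G x i ∙ pow G x j
  pow-+ x i j rewrite pow≡· x (i + j) | pow≡· x i | pow≡· x j = ×-homo-+ x i j

  pow-* : ∀ x i j → pow G (pow G x i) j ≈ pow G x (j * i)
  pow-* x i j rewrite pow≡· (pow G x i) j | pow≡· x i | pow≡· x (j * i) = ×-assocˡ x j i

  pow-ε : ∀ k → pow G ε k ≈ ε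
  pow-ε zero    = ≈-refl
  pow-ε (suc k) = trans (identityˡ _) (pow-ε k)

  pow-cancelˡ : ∀ x i d → pow G x i ≈ pow G x (i + d) → pow G x d ≈ ε
  pow-cancelˡ x i d xⁱ≈xⁱ⁺ᵈ =
    sym (∙-cancelˡ (pow G x i) ε (pow G x d) (trans (identityʳ _) (trans xⁱ≈xⁱ⁺ᵈ (pow-+ x i d))))

  pow-% : ∀ x d .{{_ : NonZero d}} → pow G x d ≈ ε → ∀ k → pow G x k ≈ pow G x (k % d)
  pow-% x d xᵈ≈ε k = begin
    pow G x k                                   ≡⟨ cong (pow G x) (m≡m%n+[m/n]*n k d) ⟩
    pow G x (k % d + k / d * d)                 ≈⟨ pow-+ x (k % d) (k / d * d) ⟩
    pow G x (k % d) ∙ pow G x (k / d * d)       ≈⟨ ∙-congˡ (pow-* x d (k / d)) ⟨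
    pow G x (k % d) ∙ pow G (pow G x d) (k / d) ≈⟨ ∙-congˡ (trans (pow-cong (k / d) xᵈ≈ε) (pow-ε (k / d))) ⟩
    pow G x (k % d) ∙ ε                         ≈⟨ identityʳ _ ⟩
    pow G x (k % d)                             ∎

  IsElemOrder-unique : ∀ {x k l} → IsElemOrder G x k → IsElemOrder G x l → k ≡ l
  IsElemOrder-unique {x} = IsLeastPositive-unique (λ j → pow G x j ≈ ε)

  IsElemOrder-resp-≈ : ∀ {x y k} → x ≈ y → IsElemOrder G x k → IsElemOrder G y k
  IsElemOrder-resp-≈ x≈y = IsLeastPositive-resp-⇔ λ j →
    mk⇔ (trans (sym (pow-cong j x≈y))) (trans (pow-cong j x≈y))

  module _ {g : Carrier} {n : ℕ} (g-order : IsElemOrder G g n) where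
    private
      instance
        n≢0 : NonZero n
        n≢0 = >-nonZero (proj₁ g-order)

      gⁿ≈ε : pow G g n ≈ ε
      gⁿ≈ε = proj₁ (proj₂ g-order)

      pow≈ε∧<⇒≡0 : ∀ {r} → r < n → pow G g r ≈ ε → r ≡ 0
      pow≈ε∧<⇒≡0 {zero}  _   _    = refl
      pow≈ε∧<⇒≡0 {suc r} r<n gʳ≈ε = contradiction gʳ≈ε (proj₂ (proj₂ g-order) (suc r) z<s r<n)

      pow≈pow∧≤⇒≥ : ∀ {i j} → i ≤ j → j < n → pow G g i ≈ pow G g j → j ≤ i
      pow≈pow∧≤⇒≥ {i} {j} i≤j j<n gⁱ≈gʲ = m∸n≡0⇒m≤n (pow≈ε∧<⇒≡0 (≤-<-trans (m∸n≤m j i) j<n)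
        (pow-cancelˡ g i (j ∸ i) (trans gⁱ≈gʲ (reflexive (cong (pow G g) (≡.sym (m+[n∸m]≡n i≤j)))))))

    pow≈ε⇔∣ : ∀ k → pow G g k ≈ ε ⇔ n ∣ k
    pow≈ε⇔∣ k = mk⇔
      (λ gᵏ≈ε → m%n≡0⇒n∣m k n (pow≈ε∧<⇒≡0 (m%n<n k n) (trans (sym (pow-% g n gⁿ≈ε k)) gᵏ≈ε)))
      (λ n∣k → trans (pow-% g n gⁿ≈ε k) (reflexive (cong (pow G g) (n∣m⇒m%n≡0 k n n∣k))))

    pow-injective : ∀ {i j} → i < n → j < n → pow G g i ≈ pow G g j → i ≡ j
    pow-injective {i} {j} i<n j<n gⁱ≈gʲ with ≤-total i j
    ... | inj₁ i≤j = ≤-antisym i≤j (pow≈pow∧≤⇒≥ i≤j j<n gⁱ≈gʲ)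
    ... | inj₂ j≤i = ≤-antisym (pow≈pow∧≤⇒≥ j≤i i<n (sym gⁱ≈gʲ)) j≤i

    IsElemOrder-pow : ∀ {r m} → IsOrderMod n r m → IsElemOrder G (pow G g r) m
    IsElemOrder-pow {r} = IsLeastPositive-resp-⇔ λ m →
      mk⇔ (trans (pow-* g r m) ∘ Equivalence.from (pow≈ε⇔∣ (m * r)))
          (Equivalence.to (pow≈ε⇔∣ (m * r)) ∘ trans (sym (pow-* g r m)))

  module _ {g : Carrier} {n : ℕ} (generates : ∀ x → ∃[ k ] (x ≈ pow G g k))
           (order-n : HasOrder G n) where
    private
      enum : Fin n → Carrier
      enum = proj₁ order-n

      index : Carrier → Fin n
      index x = proj₁ (proj₂ (proj₂ order-n) x)

      enum-index : ∀ x → enum (index x) ≈ x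
      enum-index x = proj₂ (proj₂ (proj₂ order-n) x)

      enum-injective : ∀ i j → enum i ≈ enum j → i ≡ j
      enum-injective = proj₁ (proj₂ order-n)

      -- if gᵈ ≈ ε then reducing exponents mod d injects the n elements into Fin d
      pow≈ε⇒n≤ : ∀ d → 0 < d → pow G g d ≈ ε → n ≤ d
      pow≈ε⇒n≤ d@(suc _) _ gᵈ≈ε = injective⇒≤ {f = exponent} λ {i} {j} eq →
        enum-injective i j (begin
          enum i                          ≈⟨ proj₂ (generates (enum i)) ⟩
          pow G g (k i)                   ≈⟨ pow-% g d gᵈ≈ε (k i) ⟩
          pow G g (k i % d)               ≡⟨ cong (pow G g) (fromℕ<-injective _ _ _ _ eq) ⟩
          pow G g (k j % d)               ≈⟨ pow-% g d gᵈ≈ε (k j) ⟨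
          pow G g (k j)                   ≈⟨ proj₂ (generates (enum j)) ⟨
          enum j                          ∎)
        where
        k : Fin n → ℕ
        k i = proj₁ (generates (enum i))
        exponent : Fin n → Fin d
        exponent i = fromℕ< (m%n<n (k i) d)

      -- by pigeonhole, two of g⁰, …, gⁿ coincide
      ∃pow≈ε≤n : ∃[ d ] (0 < d × d ≤ n × pow G g d ≈ ε)
      ∃pow≈ε≤n with i , j , i<j , eq ← pigeonhole (n<1+n n) (λ i → index (pow G g (toℕ i))) =
        toℕ j ∸ toℕ i , m<n⇒0<n∸m i<j , ≤-trans (m∸n≤m (toℕ j) (toℕ i)) (toℕ≤pred[n] j) ,
        pow-cancelˡ g (toℕ i) (toℕ j ∸ toℕ i) (begin
          pow G g (toℕ i)                       ≈⟨ enum-index _ ⟨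
          enum (index (pow G g (toℕ i)))        ≡⟨ cong enum eq ⟩
          enum (index (pow G g (toℕ j)))        ≈⟨ enum-index _ ⟩
          pow G g (toℕ j)                       ≡⟨ cong (pow G g) (m+[n∸m]≡n (<⇒≤ i<j)) ⟨
          pow G g (toℕ i + (toℕ j ∸ toℕ i))     ∎)

    generator-order : IsElemOrder G g n
    generator-order with d , d>0 , d≤n , gᵈ≈ε ← ∃pow≈ε≤n
      with refl ← ≤-antisym d≤n (pow≈ε⇒n≤ d d>0 gᵈ≈ε) =
      d>0 , gᵈ≈ε , λ j j>0 j<n gʲ≈ε → <⇒≱ j<n (pow≈ε⇒n≤ j j>0 gʲ≈ε)

  ODAdj⇔OrderRelated : ∀ {x y k l} → IsElemOrder G x k → IsElemOrder G y l →
                       ODAdj G x y ⇔ OrderRelated k l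
  ODAdj⇔OrderRelated {x} {y} {k} {l} x-order y-order = mk⇔
    (λ (_ , k′ , l′ , x-order′ , y-order′ , related) →
       subst₂ OrderRelated (IsElemOrder-unique x-order′ x-order) (IsElemOrder-unique y-order′ y-order) related)
    (λ related@(k≢l , _) →
       (λ x≈y → k≢l (IsElemOrder-unique (IsElemOrder-resp-≈ x≈y x-order) y-order)) ,
       k , l , x-order , y-order , related)

module ResiduesModPQ (a b : ℕ) (p-prime : Prime (suc a)) (q-prime : Prime (suc b))
                     (p≢q : suc a ≢ suc b) where

  p q n : ℕ
  p = suc a
  q = suc b
  n = p * q

  JoinGraph : Graph
  JoinGraph = seqJoin3 (emptyGraph a) (emptyGraph (a * b)) (emptyGraph b) ◇ K₁

  vertexOrder : V JoinGraph → ℕ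
  vertexOrder (inj₁ (inj₁ _))        = p
  vertexOrder (inj₁ (inj₂ (inj₁ _))) = n
  vertexOrder (inj₁ (inj₂ (inj₂ _))) = q
  vertexOrder (inj₂ _)               = 1

  private
    1<p : 1 < p
    1<p = nonTrivial⇒n>1 p {{prime⇒nonTrivial p-prime}}

    1<q : 1 < q
    1<q = nonTrivial⇒n>1 q {{prime⇒nonTrivial q-prime}}

    1∼p : OrderRelated 1 p
    1∼p = <∧∣⇒OrderRelated 1<p (1∣ p)

    1∼q : OrderRelated 1 q
    1∼q = <∧∣⇒OrderRelated 1<q (1∣ q)

    1∼n : OrderRelated 1 n
    1∼n = <∧∣⇒OrderRelated (≤-trans 1<p (m≤m*n p q)) (1∣ n)

    p∼n : OrderRelated p n
    p∼n = <∧∣⇒OrderRelated (m<m*n p q 1<q) (m∣m*n q)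

    q∼n : OrderRelated q n
    q∼n = <∧∣⇒OrderRelated (subst (q <_) (*-comm q p) (m<m*n q p 1<p)) (n∣m*n p)

    p≁q : ¬ OrderRelated p q
    p≁q = distinct-primes-unrelated p-prime q-prime p≢q

    edge : ∀ {B : Set} → B → ⊤ ⇔ B
    edge b = mk⇔ (λ _ → b) (λ _ → tt)

    nonEdge : ∀ {B : Set} → ¬ B → ⊥ ⇔ B
    nonEdge ¬b = mk⇔ ⊥-elim ¬b

  adjacency : ∀ u v → Adj JoinGraph u v ⇔ OrderRelated (vertexOrder u) (vertexOrder v)
  adjacency (inj₁ (inj₁ _))        (inj₁ (inj₁ _))        = nonEdge OrderRelated-irrefl
  adjacency (inj₁ (inj₁ _))        (inj₁ (inj₂ (inj₁ _))) = edge p∼n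
  adjacency (inj₁ (inj₁ _))        (inj₁ (inj₂ (inj₂ _))) = nonEdge p≁q
  adjacency (inj₁ (inj₁ _))        (inj₂ _)               = edge (OrderRelated-sym 1∼p)
  adjacency (inj₁ (inj₂ (inj₁ _))) (inj₁ (inj₁ _))        = edge (OrderRelated-sym p∼n)
  adjacency (inj₁ (inj₂ (inj₁ _))) (inj₁ (inj₂ (inj₁ _))) = nonEdge OrderRelated-irrefl
  adjacency (inj₁ (inj₂ (inj₁ _))) (inj₁ (inj₂ (inj₂ _))) = edge (OrderRelated-sym q∼n)
  adjacency (inj₁ (inj₂ (inj₁ _))) (inj₂ _)               = edge (OrderRelated-sym 1∼n)
  adjacency (inj₁ (inj₂ (inj₂ _))) (inj₁ (inj₁ _))        = nonEdge (p≁q ∘ OrderRelated-sym)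
  adjacency (inj₁ (inj₂ (inj₂ _))) (inj₁ (inj₂ (inj₁ _))) = edge q∼n
  adjacency (inj₁ (inj₂ (inj₂ _))) (inj₁ (inj₂ (inj₂ _))) = nonEdge OrderRelated-irrefl
  adjacency (inj₁ (inj₂ (inj₂ _))) (inj₂ _)               = edge (OrderRelated-sym 1∼q)
  adjacency (inj₂ _)               (inj₁ (inj₁ _))        = edge 1∼p
  adjacency (inj₂ _)               (inj₁ (inj₂ (inj₁ _))) = edge 1∼n
  adjacency (inj₂ _)               (inj₁ (inj₂ (inj₂ _))) = edge 1∼q
  adjacency (inj₂ _)               (inj₂ _)               = nonEdge OrderRelated-irrefl

  data Residue (r : ℕ) : Set where
    identity  : r ≡ 0 → Residue r
    ofOrder-p : (t : Fin a) → r ≡ q * suc (toℕ t) → Residue r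
    unit      : (i : Fin a) (j : Fin b) → r % p ≡ suc (toℕ i) → r % q ≡ suc (toℕ j) → Residue r
    ofOrder-q : (t : Fin b) → r ≡ p * suc (toℕ t) → Residue r

  -- The bound is irrelevant, so residueVertex below depends on r alone.
  residue : ∀ r → .(r < n) → Residue r
  residue zero      _   = identity refl
  residue r@(suc _) r<n with p ∣? r | q ∣? r
  ... | yes p∣r | yes q∣r =
    contradiction-irr r<n (λ r<n → >⇒∤ r<n (distinct-primes-∣⇒*∣ p-prime q-prime p≢q p∣r q∣r))
  ... | no _ | yes (divides s r≡sq) = uncurry ofOrder-p (positive-quotient s r<n r≡sq)
  ... | yes (divides s r≡sp) | no _ =
    uncurry ofOrder-q (positive-quotient s (subst (r <_) (*-comm p q) r<n) r≡sp)
  ... | no p∤r | no q∤r with i , r%p ← nonzero-remainder r p∤r | j , r%q ← nonzero-remainder r q∤r =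
    unit i j r%p r%q

  vertex : ∀ {r} → Residue r → V JoinGraph
  vertex (identity _)     = inj₂ fzero
  vertex (ofOrder-p t _)  = inj₁ (inj₁ t)
  vertex (unit i j _ _)   = inj₁ (inj₂ (inj₁ (combine i j)))
  vertex (ofOrder-q t _)  = inj₁ (inj₂ (inj₂ t))

  residue-order : ∀ {r} (v : Residue r) → IsOrderMod n r (vertexOrder (vertex v))
  residue-order (identity refl) = IsOrderMod-zero n
  residue-order (ofOrder-p t refl) =
    IsOrderMod-prime p-prime
                     (prime∤* p-prime (prime∤prime p-prime q-prime p≢q) (>⇒∤ (s<s (toℕ<n t))))
                     (m∣m*n q) (*-monoʳ-∣ p (m∣m*n _))
  residue-order (unit _ _ r%p r%q) =
    IsOrderMod-coprime p-prime q-prime p≢q (%≡suc⇒∤ r%p) (%≡suc⇒∤ r%q)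
  residue-order (ofOrder-q t refl) =
    IsOrderMod-prime q-prime
                     (prime∤* q-prime (prime∤prime q-prime p-prime (p≢q ∘ ≡.sym)) (>⇒∤ (s<s (toℕ<n t))))
                     (n∣m*n p) (subst (_∣ q * (p * suc (toℕ t))) (*-comm q p) (*-monoʳ-∣ q (m∣m*n _)))

  vertex-injective : ∀ {r r′} (v : Residue r) (v′ : Residue r′) → r < n → r′ < n →
                     vertex v ≡ vertex v′ → r ≡ r′
  vertex-injective (identity refl)     (identity refl)     _ _ _    = refl
  vertex-injective (ofOrder-p _ refl)  (ofOrder-p _ refl)  _ _ refl = refl
  vertex-injective (ofOrder-q _ refl)  (ofOrder-q _ refl)  _ _ refl = refl
  vertex-injective (unit i j r%p r%q) (unit i′ j′ r′%p r′%q) r<n r′<n eq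
    with refl , refl ← combine-injective i j i′ j′ (inj₁-injective (inj₂-injective (inj₁-injective eq))) =
    chineseRemainder-unique p-prime q-prime p≢q r<n r′<n
                            (≡.trans r%p (≡.sym r′%p)) (≡.trans r%q (≡.sym r′%q))
  vertex-injective (identity _)    (ofOrder-p _ _)  _ _ ()
  vertex-injective (identity _)    (unit _ _ _ _)   _ _ ()
  vertex-injective (identity _)    (ofOrder-q _ _)  _ _ ()
  vertex-injective (ofOrder-p _ _) (identity _)     _ _ ()
  vertex-injective (ofOrder-p _ _) (unit _ _ _ _)   _ _ ()
  vertex-injective (ofOrder-p _ _) (ofOrder-q _ _)  _ _ ()
  vertex-injective (unit _ _ _ _)  (identity _)     _ _ ()
  vertex-injective (unit _ _ _ _)  (ofOrder-p _ _)  _ _ ()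
  vertex-injective (unit _ _ _ _)  (ofOrder-q _ _)  _ _ ()
  vertex-injective (ofOrder-q _ _) (identity _)     _ _ ()
  vertex-injective (ofOrder-q _ _) (ofOrder-p _ _)  _ _ ()
  vertex-injective (ofOrder-q _ _) (unit _ _ _ _)   _ _ ()

  residueVertex : ∀ r → .(r < n) → V JoinGraph
  residueVertex r r<n = vertex (residue r r<n)

  residueVertex-cong : ∀ {r r′} .{r<n : r < n} .{r′<n : r′ < n} →
                       r ≡ r′ → residueVertex r r<n ≡ residueVertex r′ r′<n
  residueVertex-cong refl = refl

  private
    suc*suc : ∀ x y → x + (x * y + y) + 1 ≡ suc x * suc y
    suc*suc = solve-∀

    vertices↔ : Fin (a + (a * b + b) + 1) ↔ V JoinGraph
    vertices↔ = ↔-trans +↔⊎ (↔-trans +↔⊎ (↔-refl ⊎-↔ +↔⊎) ⊎-↔ ↔-refl)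

    vertices↣ : V JoinGraph ↣ Fin n
    vertices↣ = subst (λ m → V JoinGraph ↣ Fin m) (suc*suc a b) (↔⇒↣ (↔-sym vertices↔))

  residueVertex-surjective : ∀ v → ∃ λ (i : Fin n) → residueVertex (toℕ i) (toℕ<n i) ≡ v
  residueVertex-surjective =
    injective⇒surjective (λ {i} {j} eq → toℕ-injective (vertex-injective _ _ (toℕ<n i) (toℕ<n j) eq))
                         (Injection.injective vertices↣)

module _ {c ℓ : Level} (G : Group c ℓ) (a b : ℕ) (p-prime : Prime (suc a)) (q-prime : Prime (suc b))
         (p≢q : suc a ≢ suc b) {g : Group.Carrier G}
         (generates : ∀ x → ∃[ k ] (Group._≈_ G x (pow G g k)))
         (order-pq : HasOrder G (suc a * suc b)) where
  open Group G
  open ResiduesModPQ a b p-prime q-prime p≢q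

  private
    g-order : IsElemOrder G g n
    g-order = generator-order G generates order-pq

    log : Carrier → ℕ
    log x = proj₁ (generates x) % n

    log<n : ∀ x → log x < n
    log<n x = m%n<n (proj₁ (generates x)) n

    ≈pow-log : ∀ x → x ≈ pow G g (log x)
    ≈pow-log x = trans (proj₂ (generates x)) (pow-% G g n (proj₁ (proj₂ g-order)) (proj₁ (generates x)))

    log-pow : ∀ {r} → r < n → log (pow G g r) ≡ r
    log-pow r<n = pow-injective G g-order (log<n _) r<n (sym (≈pow-log _))

    log-cong : ∀ {x y} → x ≈ y → log x ≡ log y
    log-cong {x} {y} x≈y =
      pow-injective G g-order (log<n x) (log<n y) (trans (sym (≈pow-log x)) (trans x≈y (≈pow-log y)))

    classify : Carrier → V JoinGraph
    classify x = residueVertex (log x) (log<n x)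

    classify-order : ∀ x → IsElemOrder G x (vertexOrder (classify x))
    classify-order x = IsElemOrder-resp-≈ G (sym (≈pow-log x))
                         (IsElemOrder-pow G g-order (residue-order (residue (log x) _)))

    classify-injective : ∀ x y → classify x ≡ classify y → x ≈ y
    classify-injective x y eq = trans (≈pow-log x)
      (trans (reflexive (cong (pow G g) (vertex-injective _ _ (log<n x) (log<n y) eq))) (sym (≈pow-log y)))

    classify-surjective : ∀ v → ∃[ x ] (classify x ≡ v)
    classify-surjective v with i , eq ← residueVertex-surjective v =
      pow G g (toℕ i) , ≡.trans (residueVertex-cong (log-pow (toℕ<n i))) eq

  cyclic-pq-ODIso : ODIso G JoinGraph
  cyclic-pq-ODIso =
    classify ,
    (λ _ _ → residueVertex-cong ∘ log-cong) ,
    classify-injective ,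
    classify-surjective ,
    λ x y → ⇔-sym (adjacency (classify x) (classify y))
              ⇔-∘ ODAdj⇔OrderRelated G (classify-order x) (classify-order y)

theorem4 : {c ℓ : Level} (G : Group c ℓ) (p₁ p₂ : ℕ) →
           Prime p₁ → Prime p₂ → ¬ (p₁ ≡ p₂) →
           IsCyclic G → HasOrder G (p₁ * p₂) →
           ODIso G (seqJoin3 (emptyGraph (p₁ ∸ 1))
                             (emptyGraph ((p₁ ∸ 1) * (p₂ ∸ 1)))
                             (emptyGraph (p₂ ∸ 1))
                    ◇ K₁)
theorem4 G zero    _       p₁-prime _        _     _              _        = contradiction p₁-prime ¬prime[0]
theorem4 G (suc a) zero    _        p₂-prime _     _              _        = contradiction p₂-prime ¬prime[0]
theorem4 G (suc a) (suc b) p₁-prime p₂-prime p₁≢p₂ (g , generates) order-pq =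
  cyclic-pq-ODIso G a b p₁-prime p₂-prime p₁≢p₂ generates order-pq
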